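{- Let $k$ be a positive integer, let $n=4k+2$, and let $(a,b,c)$ be a good triple of positive integers with $a+b+c=n$ and $a=2k$. Then $b$ and $c$ are both even.
   Context: For positive integers $a,b,c$ with $n=a+b+c$, the permutation of the triple $(a,b,c)$ is the permutation of $[n]$ with $p_i=n+1-i$ for $1\le i\le a$, $p_i=a+b+1-i$ for $a+1\le i\le a+b$, and $p_i=n+b+1-i$ for $a+b+1\le i\le n$ (one-line notation $n\cdots(n-a+1)\ b\cdots1\ (b+c)\cdots(b+1)$). The triple is good if this permutation, as a bijection $i\mapsto p_i$ of $[n]$, is a single $n$-cycle. No ordering between $b$ and $c$ is assumed. -}

module Defs where

open import Data.Nat using (ℕ; zero; suc; _+_; _*_; _∸_; _≤_; _<_; _≤?_)
open import Data.Product using (∃; _×_)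
open import Relation.Binary.PropositionalEquality using (_≡_)
open import Relation.Nullary.Decidable using (yes; no)

-- The permutation of the triple (a,b,c), as a function on ℕ, meaningful on [n] = {1,…,n},
-- n = a+b+c:
--   p i = n+1-i      for 1 ≤ i ≤ a
--   p i = a+b+1-i    for a+1 ≤ i ≤ a+b
--   p i = n+b+1-i    for a+b+1 ≤ i ≤ n
-- (all truncated subtractions are genuine on these ranges).
triplePerm : ℕ → ℕ → ℕ → ℕ → ℕ
triplePerm a b c i with i ≤? a
... | yes _ = suc (a + b + c) ∸ i
... | no _ with i ≤? a + b
...   | yes _ = suc (a + b) ∸ i
...   | no _ = suc (a + b + c + b) ∸ i

iter : (ℕ → ℕ) → ℕ → ℕ → ℕ
iter f zero x = x
iter f (suc m) x = f (iter f m x)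

-- A permutation f of [n] = {1,…,n} is a single n-cycle iff it has a single orbit
-- on [n]: every j ∈ [n] is reached from every i ∈ [n] by iterating f.
IsSingleCycle : ℕ → (ℕ → ℕ) → Set
IsSingleCycle n f = ∀ i j → 1 ≤ i → i ≤ n → 1 ≤ j → j ≤ n → ∃ λ m → iter f m i ≡ j

Good : ℕ → ℕ → ℕ → Set
Good a b c = (1 ≤ a) × (1 ≤ b) × (1 ≤ c) × IsSingleCycle (a + b + c) (triplePerm a b c)

Even : ℕ → Set
Even m = ∃ λ t → m ≡ 2 * t

module Submission where

-- Let m = b + c = a + 2 and n = a + m, and let p be the permutation of (a,b,c).
-- For y ∈ [1,n] put v = p y.  Reading off the three branches of p:
--   * if y ≤ a then v > m and v + y + 1 = 2m,
--   * if y > a then v ≤ m and v + y + 1 = e·m + b for some e (namely 1 or 2).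
-- So modulo m the permutation acts as y ↦ −1 − y on [1,a] and y ↦ b − 1 − y
-- on (a,n].  A single n-cycle has no proper invariant subset of [1,n], and
-- we exhibit one whenever d = gcd(b,m) ≠ 2:
--   * d ≥ 3: the set of y with d ∣ y or d ∣ y + 1 (contains m but not 1);
--   * d = 1: by Bézout some j has j·b ≡ −1 (mod m); for the least such t the
--     points of (a,n] congruent to −1 − j·b with j < t, together with the
--     points of [1,a] sent to them, form an invariant set containing a + 1
--     but not m.
-- Hence a good triple with b + c = a + 2 has gcd(b, a+2) = 2, in particular b
-- is even; when a = 2k also a + 2 is even, hence so is c = (a + 2) − b.

open import Defs
open import Data.Nat using (ℕ; zero; suc; _+_; _*_; _∸_; _≤_; _<_; _≤?_; s≤s; z≤n)
open import Data.Nat.Properties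
open import Data.Nat.Divisibility
open import Data.Nat.GCD using (GCD; gcd; gcd-GCD; module Bézout)
open import Data.Nat.Induction using (<-rec)
open import Data.Nat.Tactic.RingSolver using (solve-∀)
open import Data.Product using (∃; _×_; _,_; proj₁; proj₂; uncurry)
open import Data.Sum using (_⊎_; inj₁; inj₂)
open import Data.Empty using (⊥; ⊥-elim)
open import Relation.Nullary using (¬_; Dec; yes; no)
open import Relation.Unary using (Decidable)
open import Relation.Binary.PropositionalEquality
  using (_≡_; refl; sym; trans; cong; subst; module ≡-Reasoning)

InRange : ℕ → ℕ → Set
InRange n y = 1 ≤ y × y ≤ n

invariant-iter : ∀ {n} (f : ℕ → ℕ) (Q : ℕ → Set) →
                 (∀ y → InRange n y → Q y → InRange n (f y) × Q (f y)) →
                 ∀ s x → InRange n x → Q x → InRange n (iter f s x) × Q (iter f s x)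
invariant-iter f Q closed zero    x x∈ qx = x∈ , qx
invariant-iter f Q closed (suc s) x x∈ qx = uncurry (closed _) (invariant-iter f Q closed s x x∈ qx)

invariant-obstructs-cycle : ∀ {n} {f : ℕ → ℕ} (Q : ℕ → Set) →
                            (∀ y → InRange n y → Q y → InRange n (f y) × Q (f y)) →
                            ∀ {i j} → InRange n i → Q i → InRange n j → ¬ Q j →
                            ¬ IsSingleCycle n f
invariant-obstructs-cycle {f = f} Q closed {i} {j} i∈ qi j∈ ¬qj cyc
  with cyc i j (proj₁ i∈) (proj₂ i∈) (proj₁ j∈) (proj₂ j∈)
... | s , reach = ¬qj (subst Q reach (proj₂ (invariant-iter f Q closed s i i∈ qi)))

least-witness : ∀ {P : ℕ → Set} → Decidable P → ∀ t → P t →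
                ∃ λ t₀ → P t₀ × (∀ j → j < t₀ → ¬ P j)
least-witness {P} P? = <-rec (λ t → P t → Least) search
  where
  Least : Set
  Least = ∃ λ t₀ → P t₀ × (∀ j → j < t₀ → ¬ P j)
  search : ∀ t → (∀ {s} → s < t → P s → Least) → P t → Least
  search t smaller Pt with anyUpTo? P? t
  ... | yes (s , s<t , Ps) = smaller s<t Ps
  ... | no none            = t , Pt , λ j j<t Pj → none (j , j<t , Pj)

minus-one-multiple : ∀ {b m′} → Bézout.Identity 1 b (suc m′) → ∃ λ j → suc m′ ∣ suc (j * b)
minus-one-multiple         (Bézout.-+ x y eq) = x , divides y eq
minus-one-multiple {b} {m′} (Bézout.+- x y eq) = m′ * x , divides (suc (m′ * y)) (begin
  suc (m′ * x * b)           ≡⟨ cong suc (*-assoc m′ x b) ⟩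
  suc (m′ * (x * b))         ≡⟨ cong (λ z → suc (m′ * z)) (sym eq) ⟩
  suc (m′ * suc (y * suc m′)) ≡⟨ expand m′ y ⟩
  suc (m′ * y) * suc m′      ∎)
  where
  open ≡-Reasoning
  expand : ∀ m′ y → suc (m′ * suc (y * suc m′)) ≡ suc (m′ * y) * suc m′
  expand = solve-∀

-- If d divides v + y + 1, then "d ∣ y or d ∣ y + 1" passes from y to v
-- (modulo d, v ≡ −1 − y swaps the classes 0 and −1).
swap-zero-minus-one : ∀ {d y v} → d ∣ v + suc y → d ∣ y ⊎ d ∣ suc y → d ∣ v ⊎ d ∣ suc v
swap-zero-minus-one {d} {y} {v} d∣sum (inj₁ d∣y) =
  inj₂ (∣m+n∣m⇒∣n (subst (d ∣_) (trans (+-suc v y) (+-comm (suc v) y)) d∣sum) d∣y)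
swap-zero-minus-one {d} {y} {v} d∣sum (inj₂ d∣y+1) =
  inj₁ (∣m+n∣m⇒∣n (subst (d ∣_) (+-comm v (suc y)) d∣sum) d∣y+1)

sum-lower-bound : ∀ {v y s l} → v + y ≡ s → l ≤ y → v + l ≤ s
sum-lower-bound {v} eq l≤y = subst (v + _ ≤_) eq (+-monoʳ-≤ v l≤y)

sum-upper-bound : ∀ {v y s u} → v + y ≡ s → y ≤ u → s ≤ v + u
sum-upper-bound {v} eq y≤u = subst (_≤ v + _) eq (+-monoʳ-≤ v y≤u)

module TriplePermutation (a b c : ℕ) (b+c≡a+2 : b + c ≡ suc (suc a)) where

  m : ℕ
  m = suc (suc a)

  n : ℕ
  n = a + b + c

  p : ℕ → ℕ
  p = triplePerm a b c

  n≡a+m : n ≡ a + m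
  n≡a+m = trans (+-assoc a b c) (cong (a +_) b+c≡a+2)

  m≤n : m ≤ n
  m≤n = subst (m ≤_) (sym n≡a+m) (m≤n+m m a)

  m∈ : InRange n m
  m∈ = s≤s z≤n , m≤n

  data Branch (y v : ℕ) : Set where
    first  : y ≤ a → v + y ≡ suc n → Branch y v
    second : a < y → y ≤ a + b → v + y ≡ suc (a + b) → Branch y v
    third  : a + b < y → v + y ≡ suc (n + b) → Branch y v

  branch : ∀ y → y ≤ n → Branch y (p y)
  branch y y≤n with y ≤? a
  ... | yes y≤a = first y≤a (m∸n+n≡m (m≤n⇒m≤1+n y≤n))
  ... | no y≰a with y ≤? a + b
  ...   | yes y≤a+b = second (≰⇒> y≰a) y≤a+b (m∸n+n≡m (m≤n⇒m≤1+n y≤a+b))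
  ...   | no y≰a+b  = third (≰⇒> y≰a+b) (m∸n+n≡m (m≤n⇒m≤1+n (≤-trans y≤n (m≤m+n n b))))

  data Step (y v : ℕ) : Set where
    low  : y ≤ a → m < v → v + suc y ≡ m + m → Step y v
    high : a < y → v ≤ m → (∃ λ e → v + suc y ≡ e * m + b) → Step y v

  step : ∀ y → InRange n y → InRange n (p y) × Step y (p y)
  step y (1≤y , y≤n) with branch y y≤n
  ... | first y≤a eq = (≤-trans (s≤s z≤n) m<v , v≤n) , low y≤a m<v sum
    where
    v : ℕ
    v = p y
    eq′ : v + y ≡ suc (a + m)
    eq′ = trans eq (cong suc n≡a+m)
    m<v : m < v
    m<v = +-cancelʳ-≤ a (suc m) v (subst (_≤ v + a) (cong suc (+-comm a m)) (sum-upper-bound eq′ y≤a))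
    v≤n : v ≤ n
    v≤n = +-cancelʳ-≤ 1 v n (subst (v + 1 ≤_) (+-comm 1 n) (sum-lower-bound eq 1≤y))
    sum : v + suc y ≡ m + m
    sum = trans (+-suc v y) (cong suc eq′)
  ... | second a<y y≤a+b eq = (1≤v , ≤-trans v≤m m≤n) , high a<y v≤m (1 , sum)
    where
    v : ℕ
    v = p y
    1≤v : 1 ≤ v
    1≤v = +-cancelʳ-≤ (a + b) 1 v (sum-upper-bound eq y≤a+b)
    v≤b : v ≤ b
    v≤b = +-cancelʳ-≤ (suc a) v b (subst (v + suc a ≤_) (+-comm (suc a) b) (sum-lower-bound eq a<y))
    v≤m : v ≤ m
    v≤m = ≤-trans v≤b (subst (b ≤_) b+c≡a+2 (m≤m+n b c))
    sum : v + suc y ≡ 1 * m + b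
    sum = trans (+-suc v y) (trans (cong suc eq) (cong (λ z → suc (suc (z + b))) (sym (+-identityʳ a))))
  ... | third a+b<y eq = (1≤v , ≤-trans v≤m m≤n) , high (≤-<-trans (m≤m+n a b) a+b<y) v≤m (2 , sum)
    where
    v : ℕ
    v = p y
    1≤v : 1 ≤ v
    1≤v = +-cancelʳ-≤ n 1 v (≤-trans (s≤s (m≤m+n n b)) (sum-upper-bound eq y≤n))
    rearrange : ∀ x y z → suc (x + y + z + y) ≡ (y + z) + suc (x + y)
    rearrange = solve-∀
    v≤m : v ≤ m
    v≤m = +-cancelʳ-≤ (suc (a + b)) v m
            (subst (v + suc (a + b) ≤_) (trans (rearrange a b c) (cong (_+ suc (a + b)) b+c≡a+2))
              (sum-lower-bound eq a+b<y))
    double : ∀ x y → suc (suc (x + suc (suc x) + y)) ≡ 2 * suc (suc x) + y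
    double = solve-∀
    sum : v + suc y ≡ 2 * m + b
    sum = trans (+-suc v y) (trans (cong suc eq) (trans (cong (λ z → suc (suc (z + b))) n≡a+m) (double a b)))

  -- A common divisor d ≥ 3 of b and m makes {y : d ∣ y or d ∣ y + 1} invariant.
  common-divisor-obstruction : ∀ {d} → 3 ≤ d → d ∣ b → d ∣ m → ¬ IsSingleCycle n p
  common-divisor-obstruction {d} 3≤d d∣b d∣m =
    invariant-obstructs-cycle Q closed m∈ (inj₁ d∣m) (s≤s z≤n , ≤-trans (s≤s z≤n) m≤n) excludes-1
    where
    Q : ℕ → Set
    Q y = d ∣ y ⊎ d ∣ suc y
    sum-divisible : ∀ {y v} → Step y v → d ∣ v + suc y
    sum-divisible (low _ _ sum)        = subst (d ∣_) (sym sum) (∣m∣n⇒∣m+n d∣m d∣m)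
    sum-divisible (high _ _ (e , sum)) = subst (d ∣_) (sym sum) (∣m∣n⇒∣m+n (∣n⇒∣m*n e d∣m) d∣b)
    closed : ∀ y → InRange n y → Q y → InRange n (p y) × Q (p y)
    closed y y∈ qy with step y y∈
    ... | v∈ , st = v∈ , swap-zero-minus-one (sum-divisible st) qy
    excludes-1 : ¬ Q 1
    excludes-1 (inj₁ d∣1) = <⇒≱ 3≤d (≤-trans (∣⇒≤ d∣1) (s≤s z≤n))
    excludes-1 (inj₂ d∣2) = <⇒≱ 3≤d (∣⇒≤ d∣2)

  -- If t is the least number with t·b ≡ −1 (mod m), the points of (a,n]
  -- congruent to −1 − j·b for some j < t, together with the points of [1,a]
  -- that p sends there, form an invariant set containing a + 1 but not m.
  module LeastInverse (t : ℕ) (m∣tb+1 : m ∣ suc (t * b))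
                      (minimal : ∀ j → j < t → ¬ m ∣ suc (j * b)) where
    open ≡-Reasoning

    -- x ≡ −1 − j·b (mod m) for some j < t
    Near : ℕ → Set
    Near x = ∃ λ j → j < t × m ∣ suc (x + j * b)

    Q : ℕ → Set
    Q y = (y ≤ a × Near (p y)) ⊎ (a < y × Near y)

    m∣m+m : m ∣ m + m
    m∣m+m = ∣m∣n⇒∣m+n ∣-refl ∣-refl

    -- t ≠ 0, since m ≥ 2 does not divide 0·b + 1.
    0<t : 0 < t
    0<t = positive m∣tb+1
      where
      positive : ∀ {s} → m ∣ suc (s * b) → 0 < s
      positive {zero}  m∣1 = ⊥-elim (<⇒≢ (s≤s (s≤s z≤n)) (sym (∣1⇒≡1 m∣1)))
      positive {suc _} _   = s≤s z≤n

    near-a+1 : Near (suc a)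
    near-a+1 = 0 , 0<t , subst (λ z → m ∣ suc (suc z)) (sym (+-identityʳ a)) ∣-refl

    -- No i·b with 1 ≤ i ≤ t is ≡ 0 (mod m), else (t − i)·b ≡ −1 earlier.
    no-zero-multiple : ∀ i → 1 ≤ i → i ≤ t → ¬ m ∣ i * b
    no-zero-multiple i 1≤i i≤t m∣ib = minimal (t ∸ i) (∸-monoʳ-< 1≤i i≤t) (∣m+n∣m⇒∣n sum m∣ib)
      where
      split : i * b + suc ((t ∸ i) * b) ≡ suc (t * b)
      split = begin
        i * b + suc ((t ∸ i) * b) ≡⟨ +-suc (i * b) _ ⟩
        suc (i * b + (t ∸ i) * b) ≡⟨ cong suc (sym (*-distribʳ-+ b i (t ∸ i))) ⟩
        suc ((i + (t ∸ i)) * b)   ≡⟨ cong (λ z → suc (z * b)) (m+[n∸m]≡n i≤t) ⟩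
        suc (t * b)               ∎
      sum : m ∣ i * b + suc ((t ∸ i) * b)
      sum = subst (m ∣_) (sym split) m∣tb+1

    high-step-multiple : ∀ {y v} j e → m ∣ suc (y + j * b) → v + suc y ≡ e * m + b →
                         m ∣ v → m ∣ suc j * b
    high-step-multiple {y} {v} j e near sum m∣v =
      ∣m+n∣m⇒∣n (subst (m ∣_) regroup (∣m∣n⇒∣m+n m∣v near)) (∣n⇒∣m*n e ∣-refl)
      where
      regroup : v + suc (y + j * b) ≡ e * m + suc j * b
      regroup = begin
        v + suc (y + j * b) ≡⟨ sym (+-assoc v (suc y) (j * b)) ⟩
        v + suc y + j * b   ≡⟨ cong (_+ j * b) sum ⟩
        e * m + b + j * b   ≡⟨ +-assoc (e * m) b (j * b) ⟩
        e * m + suc j * b   ∎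

    two-step-near : ∀ {y v u} j e → m ∣ suc (y + j * b) → v + suc y ≡ e * m + b →
                    u + suc v ≡ m + m → m ∣ suc (u + suc j * b)
    two-step-near {y} {v} {u} j e near sum sum′ =
      ∣m+n∣m⇒∣n (subst (m ∣_) (trans (sym cancelled) (+-comm _ (e * m))) (∣m∣n⇒∣m+n m∣m+m near))
                 (∣n⇒∣m*n e ∣-refl)
      where
      rearrange : ∀ u v y j b → suc (u + suc j * b) + (v + suc y) ≡ u + suc v + suc (y + j * b) + b
      rearrange = solve-∀
      shifted : suc (u + suc j * b) + e * m + b ≡ m + m + suc (y + j * b) + b
      shifted = begin
        suc (u + suc j * b) + e * m + b     ≡⟨ +-assoc (suc (u + suc j * b)) (e * m) b ⟩
        suc (u + suc j * b) + (e * m + b)   ≡⟨ cong (suc (u + suc j * b) +_) (sym sum) ⟩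
        suc (u + suc j * b) + (v + suc y)   ≡⟨ rearrange u v y j b ⟩
        u + suc v + suc (y + j * b) + b     ≡⟨ cong (λ z → z + suc (y + j * b) + b) sum′ ⟩
        m + m + suc (y + j * b) + b         ∎
      cancelled : suc (u + suc j * b) + e * m ≡ m + m + suc (y + j * b)
      cancelled = +-cancelʳ-≡ b _ _ shifted

    low-step-not-multiple : ∀ {v u} → v ≤ a → u + suc v ≡ m + m → ¬ m ∣ suc (u + t * b)
    low-step-not-multiple {v} {u} v≤a sum m∣near = <⇒≱ (s≤s (s≤s v≤a)) (∣⇒≤ m∣v+1)
      where
      m∣u : m ∣ u
      m∣u = ∣m+n∣m⇒∣n (subst (m ∣_) (trans (sym (+-suc u (t * b))) (+-comm u (suc (t * b)))) m∣near)
                       m∣tb+1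
      m∣v+1 : m ∣ suc v
      m∣v+1 = ∣m+n∣m⇒∣n (subst (m ∣_) (sym sum) m∣m+m) m∣u

    -- A high step y ↦ v from a point of the set stays in the set; the case
    -- split is on whether v lands in [1,a] (then one more step is taken) or
    -- in (a,m] = {a+1, m}.
    from-high : ∀ {y v} e → InRange n v → v ≤ m → v + suc y ≡ e * m + b → Near y →
                Dec (v ≤ a) → Q v
    from-high {v = v} e v∈ _ sum (j , j<t , near) (yes v≤a) = inj₁ (v≤a , into-low (proj₂ (step v v∈)))
      where
      into-low : ∀ {u} → Step v u → Near u
      into-low (high a<v _ _) = ⊥-elim (<⇒≱ a<v v≤a)
      into-low (low _ _ sum′) with m≤n⇒m<n∨m≡n j<t
      ... | inj₁ j+1<t = suc j , j+1<t , two-step-near j e near sum sum′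
      ... | inj₂ j+1≡t = ⊥-elim (low-step-not-multiple v≤a sum′
                          (subst (λ s → m ∣ suc (_ + s * b)) j+1≡t (two-step-near j e near sum sum′)))
    from-high e v∈ v≤m sum (j , j<t , near) (no v≰a) with m≤n⇒m<n∨m≡n v≤m
    ... | inj₂ refl = ⊥-elim (no-zero-multiple (suc j) (s≤s z≤n) j<t (high-step-multiple j e near sum ∣-refl))
    ... | inj₁ v<m with ≤-antisym (≤-pred v<m) (≰⇒> v≰a)
    ...   | refl = inj₂ (≤-refl , near-a+1)

    closed : ∀ y → InRange n y → Q y → InRange n (p y) × Q (p y)
    closed y y∈ qy with step y y∈
    ... | v∈ , low y≤a m<v _ = v∈ , inj₂ (≤-trans (n≤1+n _) (<⇒≤ m<v) , below qy)
      where
      below : Q y → Near (p y)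
      below (inj₁ (_ , near)) = near
      below (inj₂ (a<y , _))  = ⊥-elim (<⇒≱ a<y y≤a)
    ... | v∈ , high a<y v≤m (e , sum) = v∈ , from-high e v∈ v≤m sum (above qy) (p y ≤? a)
      where
      above : Q y → Near y
      above (inj₁ (y≤a , _))  = ⊥-elim (<⇒≱ a<y y≤a)
      above (inj₂ (_ , near)) = near

    excludes-m : ¬ Q m
    excludes-m (inj₁ (m≤a , _))            = <-irrefl refl (≤-trans (n≤1+n (suc a)) m≤a)
    excludes-m (inj₂ (_ , j , j<t , near)) =
      minimal j j<t (∣m+n∣m⇒∣n (subst (m ∣_) (sym (+-suc m (j * b))) near) ∣-refl)

    obstruction : ¬ IsSingleCycle n p
    obstruction = invariant-obstructs-cycle Q closed (s≤s z≤n , ≤-trans (n≤1+n _) m≤n)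
                                            (inj₂ (≤-refl , near-a+1)) m∈ excludes-m

  inverse-obstruction : (∃ λ j → m ∣ suc (j * b)) → ¬ IsSingleCycle n p
  inverse-obstruction (j , m∣jb+1) with least-witness (λ i → m ∣? suc (i * b)) j m∣jb+1
  ... | t , m∣tb+1 , minimal = LeastInverse.obstruction t m∣tb+1 minimal

single-cycle⇒2∣b : ∀ {a b c} → b + c ≡ suc (suc a) →
                   IsSingleCycle (a + b + c) (triplePerm a b c) → 2 ∣ b
single-cycle⇒2∣b {a} {b} {c} b+c≡a+2 cyc with 2 ∣? b
... | yes 2∣b = 2∣b
... | no 2∤b  = by-gcd (gcd b (suc (suc a))) (gcd-GCD b (suc (suc a)))
  where
  open TriplePermutation a b c b+c≡a+2
  by-gcd : ∀ d → GCD b m d → 2 ∣ b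
  by-gcd 0 g = ⊥-elim (2∤b (subst (2 ∣_) (sym (0∣⇒≡0 (proj₁ (GCD.commonDivisor g)))) (2 ∣0)))
  by-gcd 1 g = ⊥-elim (inverse-obstruction (minus-one-multiple (Bézout.identity g)) cyc)
  by-gcd 2 g = proj₁ (GCD.commonDivisor g)
  by-gcd (suc (suc (suc d))) g =
    ⊥-elim (common-divisor-obstruction (s≤s (s≤s (s≤s z≤n))) (proj₁ (GCD.commonDivisor g))
                                        (proj₂ (GCD.commonDivisor g)) cyc)

2∣⇒Even : ∀ {x} → 2 ∣ x → Even x
2∣⇒Even (divides q x≡q*2) = q , trans x≡q*2 (*-comm q 2)

proposition15 : (k a b c : ℕ) → 1 ≤ k → a + b + c ≡ 4 * k + 2 → a ≡ 2 * k →
                Good a b c → Even b × Even c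
proposition15 k a b c _ a+b+c≡4k+2 refl (_ , _ , _ , cyc) = 2∣⇒Even 2∣b , 2∣⇒Even 2∣c
  where
  split : ∀ k → 4 * k + 2 ≡ 2 * k + suc (suc (2 * k))
  split = solve-∀
  b+c≡a+2 : b + c ≡ suc (suc (2 * k))
  b+c≡a+2 = +-cancelˡ-≡ (2 * k) _ _ (trans (sym (+-assoc (2 * k) b c)) (trans a+b+c≡4k+2 (split k)))
  a+2≡2[k+1] : ∀ k → suc (suc (2 * k)) ≡ suc k * 2
  a+2≡2[k+1] = solve-∀
  2∣b : 2 ∣ b
  2∣b = single-cycle⇒2∣b b+c≡a+2 cyc
  2∣c : 2 ∣ c
  2∣c = ∣m+n∣m⇒∣n (subst (2 ∣_) (sym b+c≡a+2) (divides (suc k) (a+2≡2[k+1] k))) 2∣b
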